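{- Let $G$ be an abelian group with finite generating set $S=S^{ -1}$. If $g\in G$ and $\gamma$ is an infinite geodesic in the Cayley graph $(G,S)$, then $g^\star\neq v_\gamma$ as valuations on $B_G$.
   Context: Cayley graph $(G,S)$: vertex set $G$, $u,v$ adjacent iff $uv^{ -1}\in S$; $d$ is graph distance. $\phi_{y,z}(x)=d(x,y)-d(x,z)$. $B_G$ is the $\mathbb{Z}$-subalgebra of functions $G\to\mathbb{Z}$ generated by constants and all $\phi_{y,z}$. For $g\in G$, $g^\star(f)=f(g)$. A geodesic is a map $\phi:D\to G$, $D\subseteq\mathbb{N}$, with $d(\phi(e),\phi(f))=f-e$ for $e<f$ in $D$; infinite if $D$ is unbounded, with points $\gamma_0,\gamma_1,\ldots$ in increasing index order; $v_\gamma(f)=\lim_n f(\gamma_n)$ (this limit exists for $f\in B_G$). -}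

module Defs where

open import Level using (Level)
open import Algebra.Bundles using (AbelianGroup)
open import Data.Nat as ℕ using (ℕ; _≤_; _<_; _∸_)
open import Data.Integer as ℤ using (ℤ)
open import Data.List using (List; []; _∷_; foldr; length)
open import Data.List.Relation.Unary.All using (All)
open import Data.List.Relation.Unary.Any using (Any)
open import Data.Product using (Σ; ∃; _×_)
open import Relation.Binary.PropositionalEquality using (_≡_)
open import Relation.Nullary using (¬_)

module CayleyDefs {c ℓ : Level} (G : AbelianGroup c ℓ) (S : List (AbelianGroup.Carrier G)) where
  open AbelianGroup G

  InS : Carrier → Set (c Level.⊔ ℓ)
  InS x = Any (x ≈_) S

  Word : List Carrier → Set (c Level.⊔ ℓ)
  Word w = All InS w

  prod : List Carrier → Carrier
  prod = foldr _∙_ ε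

  Symmetric : Set (c Level.⊔ ℓ)
  Symmetric = ∀ s → InS s → InS (s ⁻¹)

  Generates : Set (c Level.⊔ ℓ)
  Generates = ∀ g → Σ (List Carrier) λ w → Word w × (prod w ≈ g)

  -- d is the graph distance of the Cayley graph (G,S): u,v adjacent iff u v⁻¹ ∈ S,
  -- so d x y is the least length of a word over S whose product is x y⁻¹.
  IsCayleyDist : (Carrier → Carrier → ℕ) → Set (c Level.⊔ ℓ)
  IsCayleyDist d = ∀ x y →
      (Σ (List Carrier) λ w → Word w × (length w ≡ d x y) × (prod w ≈ x ∙ y ⁻¹))
    × (∀ w → Word w → prod w ≈ x ∙ y ⁻¹ → d x y ≤ length w)

  module WithDist (d : Carrier → Carrier → ℕ) where

    φ : Carrier → Carrier → Carrier → ℤ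
    φ y z x = (d x y) ℤ.⊖ (d x z)

    -- B_G : the ℤ-subalgebra of (G → ℤ) generated by constants and all φ_{y,z}
    data InB : (Carrier → ℤ) → Set (c Level.⊔ ℓ) where
      const : (k : ℤ) → InB (λ _ → k)
      gen   : (y z : Carrier) → InB (φ y z)
      neg   : ∀ {f} → InB f → InB (λ x → ℤ.- f x)
      add   : ∀ {f h} → InB f → InB h → InB (λ x → f x ℤ.+ h x)
      mul   : ∀ {f h} → InB f → InB h → InB (λ x → f x ℤ.* h x)

    -- An infinite geodesic: ι : ℕ → ℕ strictly increasing enumerates the (unbounded)
    -- domain D ⊆ ℕ, and γ n is the point with index ι n;
    -- d(γ_n, γ_m) = ι m - ι n for n < m.
    IsInfiniteGeodesic : (ℕ → ℕ) → (ℕ → Carrier) → Set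
    IsInfiniteGeodesic ι γ =
      (∀ n m → n < m → ι n < ι m) × (∀ n m → n < m → d (γ n) (γ m) ≡ ι m ∸ ι n)

    -- v_γ(f) = lim_n f(γ_n) equals the value a (the limit of an integer sequence:
    -- eventually constant)
    LimitIs : (ℕ → Carrier) → (Carrier → ℤ) → ℤ → Set
    LimitIs γ f a = ∃ λ N → ∀ n → N ≤ n → f (γ n) ≡ a

    SameValuation : Carrier → (ℕ → Carrier) → Set (c Level.⊔ ℓ)
    SameValuation g γ = ∀ f → InB f → LimitIs γ f (f g)

-- If g⋆ = v_γ, evaluate both valuations on φ_{γ_m,g}.  Along the geodesic
-- φ_{γ_m,g}(γ_n) = (ι_n - ι_m) - d(γ_n, g), whose eventual value must be
-- d(g, γ_m) - d(g, g); hence the Busemann-type quantity d(g, γ_m) + ι_m does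
-- not depend on m.  But ι_m ≥ ι_0 + m, so d(g, γ_0) ≥ m for every m, which is
-- absurd.  Commutativity of G is only used to make d symmetric.
module Submission where

open import Defs
open import Level using (Level)
open import Algebra.Bundles using (AbelianGroup)
open import Data.Nat using (ℕ)
open import Data.List using (List)
open import Relation.Nullary using (¬_)

open import Data.Nat using (zero; suc; _+_; _∸_; _≤_; _<_; _⊔_; z≤n)
open import Data.Nat.Properties
  using ( ≤-refl; ≤-trans; ≤-reflexive; <⇒≤; ≤-<-trans; 1+n≰n; ≤-antisym
        ; +-comm; +-suc; +-identityʳ; m≤n+m; +-cancelʳ-≡; +-cancelʳ-≤
        ; m∸n+n≡m; m≤m⊔n; m≤n⊔m; module ≤-Reasoning)
open import Data.Nat.Tactic.RingSolver using (solve-∀)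
open import Data.Integer as ℤ using (+_; _⊖_)
open import Data.Integer.Properties
  using (+-injective; distribˡ-⊖-+-pos; +-cancelˡ-⊖)
open import Data.List using ([]; _∷_; map)
open import Data.List.Properties using (length-map)
import Data.List.Relation.Unary.All as All
open import Data.List.Relation.Unary.All.Properties using (map⁺)
open import Data.Product using (∃; _,_; proj₁; proj₂)
open import Relation.Binary.PropositionalEquality
  using (_≡_; sym; trans; cong; cong₂; module ≡-Reasoning)
import Algebra.Properties.AbelianGroup as AbelianGroupProperties
import Relation.Binary.Reasoning.Setoid as SetoidReasoning

m⊖n+[n+k]≡m+k : ∀ x y k → x ⊖ y ℤ.+ + (y + k) ≡ + (x + k)
m⊖n+[n+k]≡m+k x y k = begin
  x ⊖ y ℤ.+ + (y + k)         ≡⟨ distribˡ-⊖-+-pos (y + k) x y ⟩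
  (x + (y + k)) ⊖ y           ≡⟨ cong₂ _⊖_ (shuffle x y k) (sym (+-identityʳ y)) ⟩
  (y + (x + k)) ⊖ (y + 0)     ≡⟨ +-cancelˡ-⊖ y (x + k) 0 ⟩
  + (x + k)                   ∎
  where
  open ≡-Reasoning
  shuffle : ∀ x y k → x + (y + k) ≡ y + (x + k)
  shuffle = solve-∀

m⊖n≡o⊖p⇒m+p≡o+n : ∀ x y u v → x ⊖ y ≡ u ⊖ v → x + v ≡ u + y
m⊖n≡o⊖p⇒m+p≡o+n x y u v eq = +-injective (begin
  + (x + v)                   ≡⟨ sym (m⊖n+[n+k]≡m+k x y v) ⟩
  x ⊖ y ℤ.+ + (y + v)         ≡⟨ cong (λ t → t ℤ.+ + (y + v)) eq ⟩
  u ⊖ v ℤ.+ + (y + v)         ≡⟨ cong (λ t → u ⊖ v ℤ.+ + t) (+-comm y v) ⟩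
  u ⊖ v ℤ.+ + (v + y)         ≡⟨ m⊖n+[n+k]≡m+k u v y ⟩
  + (u + y)                   ∎)
  where open ≡-Reasoning

m∸n+o≡p+q⇒m+o≡p+n+q : ∀ {m n o p q} → n ≤ m → (m ∸ n) + o ≡ p + q → m + o ≡ (p + n) + q
m∸n+o≡p+q⇒m+o≡p+n+q {m} {n} {o} {p} {q} n≤m eq = begin
  m + o                       ≡⟨ cong (_+ o) (sym (m∸n+n≡m n≤m)) ⟩
  (m ∸ n) + n + o             ≡⟨ swap₂₃ (m ∸ n) n o ⟩
  (m ∸ n) + o + n             ≡⟨ cong (_+ n) eq ⟩
  p + q + n                   ≡⟨ swap₂₃ p q n ⟩
  p + n + q                   ∎
  where
  open ≡-Reasoning
  swap₂₃ : ∀ x y z → x + y + z ≡ x + z + y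
  swap₂₃ = solve-∀

strictlyIncreasing⇒offset≤ : ∀ (ι : ℕ → ℕ) → (∀ n m → n < m → ι n < ι m) →
                             ∀ m → ι 0 + m ≤ ι m
strictlyIncreasing⇒offset≤ ι mono zero    = ≤-reflexive (+-identityʳ (ι 0))
strictlyIncreasing⇒offset≤ ι mono (suc m) = begin
  ι 0 + suc m                 ≡⟨ +-suc (ι 0) m ⟩
  suc (ι 0 + m)               ≤⟨ ≤-<-trans (strictlyIncreasing⇒offset≤ ι mono m)
                                           (mono m (suc m) ≤-refl) ⟩
  ι (suc m)                   ∎
  where open ≤-Reasoning

module CayleyDistance {c ℓ : Level} (G : AbelianGroup c ℓ)
  (S : List (AbelianGroup.Carrier G)) (symm : CayleyDefs.Symmetric G S)
  (d : AbelianGroup.Carrier G → AbelianGroup.Carrier G → ℕ)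
  (isDist : CayleyDefs.IsCayleyDist G S d) where

  open AbelianGroup G hiding (refl; sym; trans)
  open AbelianGroup G using () renaming (sym to ≈-sym)
  open CayleyDefs G S
  open AbelianGroupProperties G
  open SetoidReasoning setoid

  prod-map-⁻¹ : ∀ w → prod (map _⁻¹ w) ≈ prod w ⁻¹
  prod-map-⁻¹ []      = ≈-sym ε⁻¹≈ε
  prod-map-⁻¹ (s ∷ w) = begin
    s ⁻¹ ∙ prod (map _⁻¹ w)   ≈⟨ ∙-congˡ (prod-map-⁻¹ w) ⟩
    s ⁻¹ ∙ prod w ⁻¹          ≈⟨ ⁻¹-∙-comm s (prod w) ⟩
    (s ∙ prod w) ⁻¹           ∎

  d-sym-≤ : ∀ x y → d y x ≤ d x y
  d-sym-≤ x y with proj₁ (isDist x y)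
  ... | w , word , |w|≡d , w≈xy⁻¹ =
    ≤-trans (proj₂ (isDist y x) (map _⁻¹ w) (map⁺ (All.map (symm _) word)) w⁻¹≈yx⁻¹)
            (≤-reflexive (trans (length-map _⁻¹ w) |w|≡d))
    where
    w⁻¹≈yx⁻¹ : prod (map _⁻¹ w) ≈ y ∙ x ⁻¹
    w⁻¹≈yx⁻¹ = begin
      prod (map _⁻¹ w)        ≈⟨ prod-map-⁻¹ w ⟩
      prod w ⁻¹               ≈⟨ ⁻¹-cong w≈xy⁻¹ ⟩
      (x ∙ y ⁻¹) ⁻¹           ≈⟨ ⁻¹-anti-homo‿- x y ⟩
      y ∙ x ⁻¹                ∎

  d-sym : ∀ x y → d x y ≡ d y x
  d-sym x y = ≤-antisym (d-sym-≤ y x) (d-sym-≤ x y)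

module GeodesicValuation {c ℓ : Level} (G : AbelianGroup c ℓ)
  (S : List (AbelianGroup.Carrier G)) (symm : CayleyDefs.Symmetric G S)
  (d : AbelianGroup.Carrier G → AbelianGroup.Carrier G → ℕ)
  (isDist : CayleyDefs.IsCayleyDist G S d)
  (g : AbelianGroup.Carrier G) (ι : ℕ → ℕ) (γ : ℕ → AbelianGroup.Carrier G)
  (geodesic : CayleyDefs.WithDist.IsInfiniteGeodesic G S d ι γ)
  (same : CayleyDefs.WithDist.SameValuation G S d g γ) where

  open CayleyDefs.WithDist G S d
  open CayleyDistance G S symm d isDist

  increasing : ∀ n m → n < m → ι n < ι m
  increasing = proj₁ geodesic

  eventually-busemann : ∀ m → ∃ λ N → ∀ n → N ≤ n → m < n →
                        ι n + d g g ≡ (d g (γ m) + ι m) + d (γ n) g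
  eventually-busemann m = N , λ n N≤n m<n →
    m∸n+o≡p+q⇒m+o≡p+n+q {p = d g (γ m)} {q = d (γ n) g}
      (<⇒≤ (increasing m n m<n)) (cross n N≤n m<n)
    where
    N = proj₁ (same (φ (γ m) g) (gen (γ m) g))
    limit : ∀ n → N ≤ n → d (γ n) (γ m) ⊖ d (γ n) g ≡ d g (γ m) ⊖ d g g
    limit = proj₂ (same (φ (γ m) g) (gen (γ m) g))
    d-along : ∀ {n} → m < n → d (γ n) (γ m) ≡ ι n ∸ ι m
    d-along {n} m<n = trans (d-sym (γ n) (γ m)) (proj₂ geodesic m n m<n)
    cross : ∀ n → N ≤ n → m < n → (ι n ∸ ι m) + d g g ≡ d g (γ m) + d (γ n) g
    cross n N≤n m<n = trans (cong (_+ d g g) (sym (d-along m<n)))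
      (m⊖n≡o⊖p⇒m+p≡o+n (d (γ n) (γ m)) (d (γ n) g) (d g (γ m)) (d g g) (limit n N≤n))

  busemann-constant : ∀ m → d g (γ m) + ι m ≡ d g (γ 0) + ι 0
  busemann-constant m =
    +-cancelʳ-≡ (d (γ n) g) _ _
      (trans (sym (atₘ n (≤-trans (m≤n⊔m N₀ Nₘ) (m≤m⊔n _ _)) m<n))
             (at₀ n (≤-trans (m≤m⊔n N₀ Nₘ) (m≤m⊔n _ _)) (≤-<-trans z≤n m<n)))
    where
    N₀ = proj₁ (eventually-busemann 0)
    at₀ = proj₂ (eventually-busemann 0)
    Nₘ = proj₁ (eventually-busemann m)
    atₘ = proj₂ (eventually-busemann m)
    n = (N₀ ⊔ Nₘ) ⊔ suc m
    m<n : m < n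
    m<n = m≤n⊔m (N₀ ⊔ Nₘ) (suc m)

  m≤d[g,γ₀] : ∀ m → m ≤ d g (γ 0)
  m≤d[g,γ₀] m = +-cancelʳ-≤ (ι 0) m (d g (γ 0)) (begin
    m + ι 0                   ≡⟨ +-comm m (ι 0) ⟩
    ι 0 + m                   ≤⟨ strictlyIncreasing⇒offset≤ ι increasing m ⟩
    ι m                       ≤⟨ m≤n+m (ι m) (d g (γ m)) ⟩
    d g (γ m) + ι m           ≡⟨ busemann-constant m ⟩
    d g (γ 0) + ι 0           ∎)
    where open ≤-Reasoning

mainTheorem4 : {c ℓ : Level} (G : AbelianGroup c ℓ) (S : List (AbelianGroup.Carrier G)) →
    CayleyDefs.Symmetric G S → CayleyDefs.Generates G S →
    (d : AbelianGroup.Carrier G → AbelianGroup.Carrier G → ℕ) → CayleyDefs.IsCayleyDist G S d →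
    (g : AbelianGroup.Carrier G) (ι : ℕ → ℕ) (γ : ℕ → AbelianGroup.Carrier G) →
    CayleyDefs.WithDist.IsInfiniteGeodesic G S d ι γ →
    ¬ CayleyDefs.WithDist.SameValuation G S d g γ
mainTheorem4 G S symm _ d isDist g ι γ geodesic same =
  1+n≰n (m≤d[g,γ₀] (suc (d g (γ 0))))
  where open GeodesicValuation G S symm d isDist g ι γ geodesic same
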